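{- During the execution of algorithm $\mathcal{D}^2\mathcal{I}$ on any input permutation, its last instruction (instruction 6: "otherwise perform $d_3$") can be executed only when the stack $D_1$ is empty.
   Context: The $\mathfrak{D}^2\mathfrak{I}$ machine: stacks $D_1,D_2$ (elements in decreasing order from top to bottom, top largest) followed by stack $I$ (elements in increasing order from top to bottom, top smallest). Operations: $d_0$: push next input element into $D_1$; $d_1$: pop $D_1$, push into $D_2$; $d_2$: pop $D_2$, push into $I$; $d_3$: pop $I$ and append to the output. An operation is legal if it respects the stack order restrictions. $Top(X)$ is the top element of stack $X$, and $Input$ is the next element of the input; any statement about an empty stack is considered true. Algorithm $\mathcal{D}^2\mathcal{I}$ repeatedly executes the first applicable instruction among: (1) if $Top(I)$ is the next element to be output, perform $d_3$; (2) if all elements contained in $D_1$ and $D_2$ are the next elements to be output, move them to the output; (3) perform $d_1$, provided $(\beta)$ holds; (4) perform $d_0$, provided $(\gamma)$ holds; (5) perform $d_2$, provided $(\alpha)$ holds; (6) otherwise perform $d_3$. Here $(\alpha)$: $Top(D_2)<Top(I)$; $(\beta)$: $Top(D_2)<Top(D_1)$ and $Top(D_1)<Top(I)$; $(\gamma)$: $Top(D_1)<Input$, $Input<Top(I)$, and the sequence of input elements from $Input$ up to the first input element larger than $Top(D_2)$ is increasing. Operations are only performed when legal. -}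

module Defs where

open import Data.Nat using (ℕ; suc; _≤_; _<_; _<?_; _≤?_)
open import Data.List using (List; []; _∷_; _++_; applyUpTo)
open import Data.List.Relation.Unary.All using (All)
open import Data.List.Relation.Unary.Linked using (Linked)
open import Data.List.Membership.Propositional using (_∈_)
open import Data.List.Relation.Binary.Permutation.Propositional using (_↭_)
open import Data.Product using (_×_; ∃)
open import Data.Unit using (⊤)
open import Data.Empty using (⊥)
open import Relation.Nullary using (¬_; yes; no)
open import Relation.Binary.PropositionalEquality using (_≡_)
open import Relation.Binary.Construct.Closure.ReflexiveTransitive using (Star)

-- Stacks are lists with the top as head.
-- D1, D2: top largest (decreasing from top to bottom); I: top smallest.
record State : Set where
  constructor st
  field
    input  : List ℕ   -- remaining input, next element first
    D1     : List ℕ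
    D2     : List ℕ
    I      : List ℕ
    output : List ℕ

open State public

_<ᵗ_ : ℕ → List ℕ → Set
x <ᵗ []      = ⊤
x <ᵗ (t ∷ _) = x < t

_ᵗ<_ : List ℕ → ℕ → Set
[]      ᵗ< x = ⊤
(t ∷ _) ᵗ< x = t < x

_ᵗ<ᵗ_ : List ℕ → List ℕ → Set
[]      ᵗ<ᵗ _ = ⊤
(s ∷ _) ᵗ<ᵗ t = s <ᵗ t

remaining : State → List ℕ
remaining s = input s ++ (D1 s ++ (D2 s ++ I s))

NextOut : State → ℕ → Set
NextOut s x = x ∈ remaining s × All (x ≤_) (remaining s)

upToFirstGT : ℕ → List ℕ → List ℕ
upToFirstGT t [] = []
upToFirstGT t (y ∷ ys) with t <? y
... | yes _ = y ∷ []
... | no  _ = y ∷ upToFirstGT t ys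

-- third part of (γ); true if D2 is empty
IncPrefix : List ℕ → List ℕ → Set
IncPrefix []      inp = ⊤
IncPrefix (t ∷ _) inp = Linked _<_ (upToFirstGT t inp)

insert : ℕ → List ℕ → List ℕ
insert x [] = x ∷ []
insert x (y ∷ ys) with x ≤? y
... | yes _ = x ∷ y ∷ ys
... | no  _ = y ∷ insert x ys

sort : List ℕ → List ℕ
sort [] = []
sort (x ∷ xs) = insert x (sort xs)

Cond1 : State → Set
Cond1 s with I s
... | []    = ⊥
... | t ∷ _ = NextOut s t

Cond2 : State → Set
Cond2 s = ¬ (D1 s ++ D2 s ≡ [])
        × All (λ x → All (x <_) (input s ++ I s)) (D1 s ++ D2 s)

-- (3) d1 legal (D1 nonempty, Top(D2) < Top(D1)) and (β)
Cond3 : State → Set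
Cond3 s with D1 s
... | []    = ⊥
... | a ∷ _ = (D2 s ᵗ< a) × (a <ᵗ I s)

-- (4) d0 legal (input nonempty, Top(D1) < Input) and (γ)
Cond4 : State → Set
Cond4 s with input s
... | []    = ⊥
... | x ∷ _ = (D1 s ᵗ< x) × (x <ᵗ I s) × IncPrefix (D2 s) (input s)

-- (5) d2 legal (D2 nonempty, Top(D2) < Top(I)) and (α)
Cond5 : State → Set
Cond5 s with D2 s
... | []    = ⊥
... | a ∷ _ = a <ᵗ I s

data Step : State → State → Set where
  step1 : ∀ {inp d1 d2 t i out} →
          Cond1 (st inp d1 d2 (t ∷ i) out) →
          Step (st inp d1 d2 (t ∷ i) out) (st inp d1 d2 i (out ++ t ∷ []))
  step2 : ∀ {s} → ¬ Cond1 s → Cond2 s →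
          Step s (st (input s) [] [] (I s) (output s ++ sort (D1 s ++ D2 s)))
  step3 : ∀ {inp a d1 d2 i out} →
          ¬ Cond1 (st inp (a ∷ d1) d2 i out) →
          ¬ Cond2 (st inp (a ∷ d1) d2 i out) →
          Cond3 (st inp (a ∷ d1) d2 i out) →
          Step (st inp (a ∷ d1) d2 i out) (st inp d1 (a ∷ d2) i out)
  step4 : ∀ {x inp d1 d2 i out} →
          ¬ Cond1 (st (x ∷ inp) d1 d2 i out) →
          ¬ Cond2 (st (x ∷ inp) d1 d2 i out) →
          ¬ Cond3 (st (x ∷ inp) d1 d2 i out) →
          Cond4 (st (x ∷ inp) d1 d2 i out) →
          Step (st (x ∷ inp) d1 d2 i out) (st inp (x ∷ d1) d2 i out)
  step5 : ∀ {inp d1 a d2 i out} →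
          ¬ Cond1 (st inp d1 (a ∷ d2) i out) →
          ¬ Cond2 (st inp d1 (a ∷ d2) i out) →
          ¬ Cond3 (st inp d1 (a ∷ d2) i out) →
          ¬ Cond4 (st inp d1 (a ∷ d2) i out) →
          Cond5 (st inp d1 (a ∷ d2) i out) →
          Step (st inp d1 (a ∷ d2) i out) (st inp d1 d2 (a ∷ i) out)
  step6 : ∀ {inp d1 d2 t i out} →
          ¬ Cond1 (st inp d1 d2 (t ∷ i) out) →
          ¬ Cond2 (st inp d1 d2 (t ∷ i) out) →
          ¬ Cond3 (st inp d1 d2 (t ∷ i) out) →
          ¬ Cond4 (st inp d1 d2 (t ∷ i) out) →
          ¬ Cond5 (st inp d1 d2 (t ∷ i) out) →
          Step (st inp d1 d2 (t ∷ i) out) (st inp d1 d2 i (out ++ t ∷ []))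

Executes6 : State → Set
Executes6 s = ¬ Cond1 s × ¬ Cond2 s × ¬ Cond3 s × ¬ Cond4 s × ¬ Cond5 s
            × ¬ (I s ≡ [])

initial : List ℕ → State
initial xs = st xs [] [] [] []

IsPerm : ℕ → List ℕ → Set
IsPerm n xs = xs ↭ applyUpTo suc n

Reachable : List ℕ → State → Set
Reachable xs s = Star Step (initial xs) s

module Submission where

-- Along every run of algorithm D²I on a
-- permutation, the following hold (record 'Invariant'):
--   * the not-yet-output elements are pairwise distinct;
--   * D1 and D2 are decreasing and I is increasing from the top down;
--   * Top(D1) < Top(I) and Top(D2) < Top(I).
-- The invariant holds initially and every step preserves it; the only
-- delicate case is d2 (instruction 5), where Top(D1) < Top(I) must be
-- re-established against the new top of I: distinctness excludes
-- Top(D1) = Top(D2), and Top(D2) < Top(D1) would have made instruction (3)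
-- applicable. Finally, under the invariant a nonempty D1 makes instruction
-- (3) applicable when D2 is empty and instruction (5) applicable otherwise,
-- so (6) can only execute with D1 empty.

open import Defs
open import Data.Nat using (ℕ; suc; _<_; _>_)
open import Data.Nat.Properties using (<-trans; ≤∧≢⇒<; ≮⇒≥; suc-injective; <⇒≢)
open import Data.List using (List; []; _∷_; _++_; applyUpTo)
open import Data.List.Properties using (++-identityʳ)
open import Data.List.Relation.Unary.All using ([]; _∷_)
open import Data.List.Relation.Unary.Linked using (Linked; []; [-]; _∷_)
import Data.List.Relation.Unary.Linked as Linked
open import Data.List.Relation.Unary.Unique.Propositional using (Unique; []; _∷_)
open import Data.List.Relation.Unary.Unique.Propositional.Properties using (applyUpTo⁺₁)
open import Data.List.Relation.Binary.Sublist.Propositional using (_⊆_; []; _∷_; _∷ʳ_; ⊆-refl; minimum)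
open import Data.List.Relation.Binary.Sublist.Propositional.Properties
  using (All-resp-⊆)
  renaming (++⁺ˡ to ⊆-++⁺ˡ; ++⁺ to ⊆-++⁺)
open import Data.List.Relation.Binary.Permutation.Propositional using (_↭_; ↭-sym; ↭⇒↭ₛ)
open import Data.List.Relation.Binary.Permutation.Propositional.Properties
  using (shift)
  renaming (++⁺ˡ to ↭-++⁺ˡ)
import Data.List.Relation.Binary.Permutation.Setoid.Properties as SetoidPerm
open import Data.Product using (_,_)
open import Data.Unit using (tt)
open import Data.Empty using (⊥-elim)
open import Relation.Nullary using (¬_)
open import Relation.Binary.PropositionalEquality using (_≡_; _≢_; refl; sym; subst; setoid)
open import Relation.Binary.Construct.Closure.ReflexiveTransitive using (Star; ε; _◅_)

unique-↭ : {xs ys : List ℕ} → xs ↭ ys → Unique xs → Unique ys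
unique-↭ p = SetoidPerm.Unique-resp-↭ (setoid ℕ) (↭⇒↭ₛ p)

unique-⊆ : {xs ys : List ℕ} → xs ⊆ ys → Unique ys → Unique xs
unique-⊆ []         []         = []
unique-⊆ (_ ∷ʳ sub) (_ ∷ u)    = unique-⊆ sub u
unique-⊆ (refl ∷ sub) (x∉ ∷ u) = All-resp-⊆ sub x∉ ∷ unique-⊆ sub u

⊆-prefix : (xs : List ℕ) {ys zs : List ℕ} → ys ⊆ zs → xs ++ ys ⊆ xs ++ zs
⊆-prefix xs = ⊆-++⁺ (⊆-refl {x = xs})

distinct-pair : {c a : ℕ} {xs : List ℕ} → c ∷ a ∷ [] ⊆ xs → Unique xs → c ≢ a
distinct-pair sub u with unique-⊆ sub u
... | (c≢a ∷ []) ∷ _ = c≢a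

<ᵗ-trans : {b a : ℕ} (i : List ℕ) → b < a → a <ᵗ i → b <ᵗ i
<ᵗ-trans []      _   _   = tt
<ᵗ-trans (_ ∷ _) b<a a<t = <-trans b<a a<t

ᵗ<ᵗ-pop : (d : List ℕ) {t : ℕ} {i : List ℕ} →
          Linked _<_ (t ∷ i) → d ᵗ<ᵗ (t ∷ i) → d ᵗ<ᵗ i
ᵗ<ᵗ-pop []      _          _   = tt
ᵗ<ᵗ-pop (_ ∷ _) [-]       _   = tt
ᵗ<ᵗ-pop (_ ∷ _) (t<u ∷ _) b<t = <-trans b<t t<u

decreasing-below : {a : ℕ} (d i : List ℕ) → Linked _>_ (a ∷ d) → a <ᵗ i → d ᵗ<ᵗ i
decreasing-below []      _ _   _   = tt
decreasing-below (_ ∷ _) i lnk a<i = <ᵗ-trans i (Linked.head lnk) a<i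

push-decreasing : {x : ℕ} (d : List ℕ) → d ᵗ< x → Linked _>_ d → Linked _>_ (x ∷ d)
push-decreasing []      _   _   = [-]
push-decreasing (_ ∷ _) y<x lnk = y<x ∷ lnk

push-increasing : {x : ℕ} (i : List ℕ) → x <ᵗ i → Linked _<_ i → Linked _<_ (x ∷ i)
push-increasing []      _   _   = [-]
push-increasing (_ ∷ _) x<y lnk = x<y ∷ lnk

record Invariant (s : State) : Set where
  field
    distinct      : Unique (remaining s)
    D1-decreasing : Linked _>_ (D1 s)
    D2-decreasing : Linked _>_ (D2 s)
    I-increasing  : Linked _<_ (I s)
    D1-below-I    : D1 s ᵗ<ᵗ I s
    D2-below-I    : D2 s ᵗ<ᵗ I s

open Invariant

-- Permutations of 1..n are duplicate-free, so the invariant holds initially.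
initial-invariant : (n : ℕ) (xs : List ℕ) → IsPerm n xs → Invariant (initial xs)
initial-invariant n xs perm = record
  { distinct      = subst Unique (sym (++-identityʳ xs)) (unique-↭ (↭-sym perm) oneToN-unique)
  ; D1-decreasing = []
  ; D2-decreasing = []
  ; I-increasing  = []
  ; D1-below-I    = tt
  ; D2-below-I    = tt
  }
  where
  oneToN-unique : Unique (applyUpTo suc n)
  oneToN-unique = applyUpTo⁺₁ suc n (λ i<j _ eq → <⇒≢ i<j (suc-injective eq))

pop-I-preserves : {inp d1 d2 i out out′ : List ℕ} {t : ℕ} →
                  Invariant (st inp d1 d2 (t ∷ i) out) → Invariant (st inp d1 d2 i out′)
pop-I-preserves {inp} {d1} {d2} {i} {t = t} inv = record
  { distinct      = unique-⊆ drop-t (distinct inv)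
  ; D1-decreasing = D1-decreasing inv
  ; D2-decreasing = D2-decreasing inv
  ; I-increasing  = Linked.tail (I-increasing inv)
  ; D1-below-I    = ᵗ<ᵗ-pop d1 (I-increasing inv) (D1-below-I inv)
  ; D2-below-I    = ᵗ<ᵗ-pop d2 (I-increasing inv) (D2-below-I inv)
  }
  where
  drop-t : inp ++ (d1 ++ (d2 ++ i)) ⊆ inp ++ (d1 ++ (d2 ++ (t ∷ i)))
  drop-t = ⊆-prefix inp (⊆-prefix d1 (⊆-prefix d2 (t ∷ʳ ⊆-refl)))

flush-preserves : {inp d1 d2 i out out′ : List ℕ} →
                  Invariant (st inp d1 d2 i out) → Invariant (st inp [] [] i out′)
flush-preserves {inp} {d1} {d2} {i} inv = record
  { distinct      = unique-⊆ drop-D1D2 (distinct inv)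
  ; D1-decreasing = []
  ; D2-decreasing = []
  ; I-increasing  = I-increasing inv
  ; D1-below-I    = tt
  ; D2-below-I    = tt
  }
  where
  drop-D1D2 : inp ++ i ⊆ inp ++ (d1 ++ (d2 ++ i))
  drop-D1D2 = ⊆-prefix inp (⊆-++⁺ˡ d1 (⊆-++⁺ˡ d2 ⊆-refl))

d1-preserves : {inp d1 d2 i out : List ℕ} {a : ℕ} → d2 ᵗ< a → a <ᵗ i →
               Invariant (st inp (a ∷ d1) d2 i out) → Invariant (st inp d1 (a ∷ d2) i out)
d1-preserves {inp} {d1} {d2} {i} {a = a} d2<a a<i inv = record
  { distinct      = unique-↭ (↭-++⁺ˡ inp (↭-sym (shift a d1 (d2 ++ i)))) (distinct inv)
  ; D1-decreasing = Linked.tail (D1-decreasing inv)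
  ; D2-decreasing = push-decreasing d2 d2<a (D2-decreasing inv)
  ; I-increasing  = I-increasing inv
  ; D1-below-I    = decreasing-below d1 i (D1-decreasing inv) a<i
  ; D2-below-I    = a<i
  }

-- d0 under (γ) (instruction 4); only the first two conditions of (γ) matter.
d0-preserves : {inp d1 d2 i out : List ℕ} {x : ℕ} → d1 ᵗ< x → x <ᵗ i →
               Invariant (st (x ∷ inp) d1 d2 i out) → Invariant (st inp (x ∷ d1) d2 i out)
d0-preserves {inp} {d1} {d2} {i} {x = x} d1<x x<i inv = record
  { distinct      = unique-↭ (↭-sym (shift x inp (d1 ++ (d2 ++ i)))) (distinct inv)
  ; D1-decreasing = push-decreasing d1 d1<x (D1-decreasing inv)
  ; D2-decreasing = D2-decreasing inv
  ; I-increasing  = I-increasing inv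
  ; D1-below-I    = x<i
  ; D2-below-I    = D2-below-I inv
  }

-- When d2 moves a = Top(D2) onto I, Top(D1) stays below the new top a:
-- the two are distinct, and a < Top(D1) would make instruction (3) applicable.
D1-below-moved : (inp d1 d2 i out : List ℕ) (a : ℕ) →
                 Unique (inp ++ (d1 ++ ((a ∷ d2) ++ i))) → d1 ᵗ<ᵗ i →
                 ¬ Cond3 (st inp d1 (a ∷ d2) i out) → d1 ᵗ<ᵗ (a ∷ i)
D1-below-moved inp []        d2 i out a _ _   _   = tt
D1-below-moved inp (c ∷ d1′) d2 i out a u c<i ¬β =
  ≤∧≢⇒< (≮⇒≥ (λ a<c → ¬β (a<c , c<i))) (distinct-pair c-before-a u)
  where
  c-before-a : c ∷ a ∷ [] ⊆ inp ++ (c ∷ d1′ ++ (a ∷ d2 ++ i))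
  c-before-a = ⊆-++⁺ˡ inp (refl ∷ ⊆-++⁺ˡ d1′ (refl ∷ minimum _))

d2-preserves : {inp d1 d2 i out : List ℕ} {a : ℕ} → a <ᵗ i →
               ¬ Cond3 (st inp d1 (a ∷ d2) i out) →
               Invariant (st inp d1 (a ∷ d2) i out) → Invariant (st inp d1 d2 (a ∷ i) out)
d2-preserves {inp} {d1} {d2} {i} {out} {a} a<i ¬β inv = record
  { distinct      = unique-↭ (↭-++⁺ˡ inp (↭-++⁺ˡ d1 (↭-sym (shift a d2 i)))) (distinct inv)
  ; D1-decreasing = D1-decreasing inv
  ; D2-decreasing = Linked.tail (D2-decreasing inv)
  ; I-increasing  = push-increasing i a<i (I-increasing inv)
  ; D1-below-I    = D1-below-moved inp d1 d2 i out a (distinct inv) (D1-below-I inv) ¬β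
  ; D2-below-I    = D2-below-new-top d2 (D2-decreasing inv)
  }
  where
  D2-below-new-top : (d : List ℕ) → Linked _>_ (a ∷ d) → d ᵗ<ᵗ (a ∷ i)
  D2-below-new-top []      _   = tt
  D2-below-new-top (_ ∷ _) lnk = Linked.head lnk

step-preserves : {s s′ : State} → Step s s′ → Invariant s → Invariant s′
step-preserves (step1 _)                        = pop-I-preserves
step-preserves (step2 _ _)                      = flush-preserves
step-preserves (step3 _ _ (d2<a , a<i))         = d1-preserves d2<a a<i
step-preserves (step4 _ _ _ (d1<x , x<i , _))   = d0-preserves d1<x x<i
step-preserves (step5 _ _ ¬β _ a<i)             = d2-preserves a<i ¬β
step-preserves (step6 _ _ _ _ _)                = pop-I-preserves

reachable-invariant : {n : ℕ} {xs : List ℕ} {s : State} →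
                      IsPerm n xs → Reachable xs s → Invariant s
reachable-invariant {n} {xs} perm run = go run (initial-invariant n xs perm)
  where
  go : {s s′ : State} → Star Step s s′ → Invariant s → Invariant s′
  go ε          inv = inv
  go (step ◅ r) inv = go r (step-preserves step inv)

-- Under the invariant, a nonempty D1 makes (3) applicable if D2 is empty
-- and (5) applicable otherwise.
D1-empty-if-blocked : (s : State) → Invariant s → ¬ Cond3 s → ¬ Cond5 s → D1 s ≡ []
D1-empty-if-blocked (st inp [] d2 i out)             _   _  _  = refl
D1-empty-if-blocked (st inp (a ∷ d1) [] i out)       inv ¬β _  = ⊥-elim (¬β (tt , D1-below-I inv))
D1-empty-if-blocked (st inp (a ∷ d1) (b ∷ d2) i out) inv _  ¬α = ⊥-elim (¬α (D2-below-I inv))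

corollary3 : (n : ℕ) (xs : List ℕ) (s : State) →
    IsPerm n xs → Reachable xs s → Executes6 s → D1 s ≡ []
corollary3 n xs s perm run (_ , _ , ¬β , _ , ¬α , _) =
  D1-empty-if-blocked s (reachable-invariant perm run) ¬β ¬α
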